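{- Let $i\in\{1,2\}$ and $\mathcal Q_i,l_i,H_i$ be as in the context. Let $2\le q\le H_i$ with $l_i(q)=d$ (a positive integer), and let $1\le a<q$ with $(a,q)=1$. Then there exist $S\subseteq\mathcal Q_i$ with $|S|=d$ and an integer $b$ with $1\le b<R_S:=\prod_{m\in S}m$ such that $\frac aq=\frac{b}{R_S}$ and $m\nmid b$ for every $m\in S$.
   Context: Fix $\epsilon>0$, constants $C_1,C_2,C_3>0$, $\alpha\in(0,1)$ and $L=\log(1/\alpha)$. Let $P_{1,\max}=\max\{C_1\alpha^{ -(2+\epsilon)},L^{2+\epsilon}\}$, $q_{1,1}=(\prod_{p\le L^{2+\epsilon}}p)^{\lceil2(2+\epsilon)L\rceil}$, and $\mathcal Q_1$ consists of $q_{1,1}$ together with, for each prime $p\in(L^{2+\epsilon},P_{1,\max}]$, the largest power of $p$ not exceeding $P_{1,\max}$. Let $P_{2,\max}=\max\{C_2L^{(2+\epsilon)\lfloor\log L\rfloor},C_3L^{3+\epsilon}\}$, $q_{2,1}=(\prod_{p\le C_3L^{3+\epsilon}}p)^{\lceil2(2+\epsilon)(\log L)^2\rceil}$, and $\mathcal Q_2$ consists of $q_{2,1}$ together with, for each prime $p\in(C_3L^{3+\epsilon},P_{2,\max}]$, the largest power of $p$ not exceeding $P_{2,\max}$. The elements of each $\mathcal Q_i$ are pairwise coprime. For $r\in\mathbb{N}$, $l_i(r)=\min\{|S|:S\subseteq\mathcal Q_i,\ r\mid\prod_{m\in S}m\}$. $H_1=C_1\alpha^{ -(2+\epsilon)}$,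 $H_2=C_2L^{(2+\epsilon)\lfloor\log L\rfloor}$. -}

module Defs where

open import Data.Nat using (ℕ; zero; suc; _+_; _*_; _^_; _≤_; _<_; _<?_; _≤?_; _⊔_)
open import Data.Nat.Divisibility using (_∣_)
open import Data.Nat.Primality using (prime?)
open import Data.Nat.ListAction using (product)
open import Relation.Binary.PropositionalEquality using (_≡_)
open import Data.List using (List; []; _∷_; map; filter; foldr; upTo; length)
open import Data.Vec using (Vec; []; _∷_; fromList)
open import Data.Fin.Subset using (Subset; inside; outside; ∣_∣)
open import Data.Product using (Σ; _×_)

primesUpTo : ℕ → List ℕ
primesUpTo n = filter prime? (upTo (suc n))

primesIn : ℕ → ℕ → List ℕ
primesIn B P = filter (B <?_) (primesUpTo P)

primorial : ℕ → ℕ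
primorial B = product (primesUpTo B)

-- the largest power p^k (k ≥ 0) of p with p^k ≤ P  (for p ≥ 2 every such k is ≤ P)
largestPow : ℕ → ℕ → ℕ
largestPow p P = foldr _⊔_ 0 (filter (_≤? P) (map (p ^_) (upTo (suc P))))

-- The family 𝒬 determined by the integer data
--   B = ⌊prime threshold⌋ (L^{2+ε} for i=1, C₃L^{3+ε} for i=2),
--   e = the exponent (⌈2(2+ε)L⌉ for i=1, ⌈2(2+ε)(log L)²⌉ for i=2),
--   P = ⌊P_{i,max}⌋.
-- 𝒬 = { (∏_{p≤B} p)^e } ∪ { largest power of p ≤ P : p prime, B < p ≤ P }.
Qlist : ℕ → ℕ → ℕ → List ℕ
Qlist B e P = primorial B ^ e ∷ map (λ p → largestPow p P) (primesIn B P)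

Qvec : (B e P : ℕ) → Vec ℕ (length (Qlist B e P))
Qvec B e P = fromList (Qlist B e P)

prodS : ∀ {n} → Vec ℕ n → Subset n → ℕ
prodS []       []            = 1
prodS (x ∷ xs) (inside ∷ s)  = x * prodS xs s
prodS (x ∷ xs) (outside ∷ s) = prodS xs s

-- l(r) = d :  d = min { |S| : S ⊆ 𝒬, r ∣ ∏_{m∈S} m }  (minimum attained and equal to d)
lEq : ∀ {n} → Vec ℕ n → ℕ → ℕ → Set
lEq Q r d =
  Σ (Subset _) (λ S → ∣ S ∣ ≡ d × r ∣ prodS Q S)
  × (∀ S → r ∣ prodS Q S → d ≤ ∣ S ∣)

{-# OPTIONS --safe #-}
-- Take S attaining l(q) = d, write R_S = k q and put b = a k, so that a/q = b/R_S with
-- 1 ≤ b < R_S. If some m ∈ S divided b, cancelling m from a R_S = b q would give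
-- q ∣ a R_{S ∖ {m}}, hence q ∣ R_{S ∖ {m}} because (a, q) = 1, contradicting the
-- minimality of |S|.
module Submission where

open import Defs
open import Data.Nat using (ℕ; suc; _*_; _^_; _⊔_; _≤?_; _≤_; _<_; NonZero; >-nonZero; >-nonZero⁻¹)
open import Data.Nat.Properties
open import Data.Nat.Divisibility using (_∣_; divides)
open import Data.Nat.Coprimality using (Coprime; coprime-divisor)
import Data.Nat.Coprimality as Coprimality
open import Data.Nat.Primality using (prime?; productOfPrimes≢0)
open import Data.List using (List; foldr; filter; map; applyUpTo; upTo)
import Data.List.Relation.Unary.All as ListAll
open import Data.List.Relation.Unary.All.Properties using (all-filter; map⁺)
open import Data.Vec using (Vec; []; _∷_; lookup; here; there)
open import Data.Vec.Relation.Unary.All using (All; []; _∷_)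
open import Data.Vec.Relation.Unary.All.Properties using (fromList⁺; lookup⁺)
open import Data.Fin using (suc)
open import Data.Fin.Subset using (Subset; _∈_; _-_; ∣_∣; inside; outside)
open import Data.Fin.Subset.Properties using (p─⊥≡p; x∈p⇒∣p-x∣<∣p∣)
open import Data.Product using (Σ; _×_; _,_)
open import Relation.Binary.PropositionalEquality
open import Relation.Nullary using (¬_)

open import Algebra.Properties.CommutativeSemigroup *-commutativeSemigroup using (x∙yz≈y∙xz)

prodS≢0 : ∀ {n} {Q : Vec ℕ n} → All NonZero Q → ∀ S → NonZero (prodS Q S)
prodS≢0 []            []            = _
prodS≢0 (x≢0 ∷ Q≢0) (inside  ∷ S) = m*n≢0 _ _ {{x≢0}} {{prodS≢0 Q≢0 S}}
prodS≢0 (_   ∷ Q≢0) (outside ∷ S) = prodS≢0 Q≢0 S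

prodS-remove : ∀ {n} (Q : Vec ℕ n) {S : Subset n} {j} → j ∈ S →
               prodS Q S ≡ lookup Q j * prodS Q (S - j)
prodS-remove (x ∷ Q) {inside ∷ S}          here        = cong (λ T → x * prodS Q T) (sym (p─⊥≡p S))
prodS-remove (x ∷ Q) {inside ∷ S}  {suc j} (there j∈S) =
  trans (cong (x *_) (prodS-remove Q j∈S)) (x∙yz≈y∙xz x (lookup Q j) (prodS Q (S - j)))
prodS-remove (x ∷ Q) {outside ∷ S}         (there j∈S) = prodS-remove Q j∈S

coprime-cofactor-∣ : ∀ {a q m r b} .{{_ : NonZero m}} →
                     Coprime a q → a * (m * r) ≡ b * q → m ∣ b → q ∣ r
coprime-cofactor-∣ {a} {q} {m} {r} a⊥q amr≡bq (divides c refl) =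
  coprime-divisor (Coprimality.sym a⊥q) (divides c (*-cancelˡ-≡ (a * r) (c * q) m mar≡mcq))
  where
  open ≡-Reasoning
  mar≡mcq : m * (a * r) ≡ m * (c * q)
  mar≡mcq = begin
    m * (a * r)  ≡⟨ x∙yz≈y∙xz m a r ⟩
    a * (m * r)  ≡⟨ amr≡bq ⟩
    c * m * q    ≡⟨ cong (_* q) (*-comm c m) ⟩
    m * c * q    ≡⟨ *-assoc m c q ⟩
    m * (c * q)  ∎

minimal-cover⇒no-factor : ∀ {n} (Q : Vec ℕ n) → All NonZero Q →
  ∀ {q d a b} {S : Subset n} → (∀ T → q ∣ prodS Q T → d ≤ ∣ T ∣) → ∣ S ∣ ≡ d →
  Coprime a q → a * prodS Q S ≡ b * q → ∀ j → j ∈ S → ¬ (lookup Q j ∣ b)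
minimal-cover⇒no-factor Q Q≢0 {a = a} {S = S} minimal refl a⊥q aR≡bq j j∈S m∣b =
  <⇒≱ (x∈p⇒∣p-x∣<∣p∣ j∈S) (minimal (S - j) q∣R′)
  where
  q∣R′ : _ ∣ prodS Q (S - j)
  q∣R′ = coprime-cofactor-∣ {{lookup⁺ Q≢0 j}} a⊥q
           (trans (cong (a *_) (sym (prodS-remove Q j∈S))) aR≡bq) m∣b

minimal-cover⇒representation : ∀ {n} (Q : Vec ℕ n) → All NonZero Q →
  ∀ {q d a} → lEq Q q d → 1 ≤ a → a < q → Coprime a q →
  Σ (Subset n) (λ S → ∣ S ∣ ≡ d × Σ ℕ (λ b →
    1 ≤ b × b < prodS Q S
    × a * prodS Q S ≡ b * q
    × (∀ j → j ∈ S → ¬ (lookup Q j ∣ b))))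
minimal-cover⇒representation Q Q≢0 {q} {a = a} ((S , ∣S∣≡d , divides k R≡kq) , minimal) 1≤a a<q a⊥q =
  S , ∣S∣≡d , a * k , *-mono-≤ 1≤a (>-nonZero⁻¹ k) , ak<R , aR≡akq ,
  minimal-cover⇒no-factor Q Q≢0 minimal ∣S∣≡d a⊥q aR≡akq
  where
  instance
    k≢0 : NonZero k
    k≢0 = m*n≢0⇒m≢0 k {{subst NonZero R≡kq (prodS≢0 Q≢0 S)}}
  ak<R : a * k < prodS Q S
  ak<R = subst (a * k <_) (sym (trans R≡kq (*-comm k q))) (*-monoˡ-< k a<q)
  aR≡akq : a * prodS Q S ≡ a * k * q
  aR≡akq = trans (cong (a *_) R≡kq) (sym (*-assoc a k q))

primorial≢0 : ∀ B → NonZero (primorial B)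
primorial≢0 B = productOfPrimes≢0 (all-filter prime? (upTo (suc B)))

-- p⁰ = 1 is the first candidate power, and it is admitted as soon as P ≥ 1.
largestPow≢0 : ∀ p P → 1 ≤ P → NonZero (largestPow p P)
largestPow≢0 p (suc P) _ = >-nonZero (m≤m⊔n 1 (foldr _⊔_ 0 (filter (_≤? suc P) higherPowers)))
  where
  higherPowers : List ℕ
  higherPowers = map (p ^_) (applyUpTo suc (suc P))

Qvec≢0 : ∀ B e P → 1 ≤ P → All NonZero (Qvec B e P)
Qvec≢0 B e P 1≤P = fromList⁺
  (m^n≢0 (primorial B) e {{primorial≢0 B}} ListAll.∷ map⁺ (ListAll.universal (λ p → largestPow≢0 p P 1≤P) _))

lemma12p5 : (B e P H : ℕ) → B ≤ P → H ≤ P →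
    (q d a : ℕ) → 2 ≤ q → q ≤ H → lEq (Qvec B e P) q d → 1 ≤ d →
    1 ≤ a → a < q → Coprime a q →
    Σ (Subset _) (λ S → ∣ S ∣ ≡ d × Σ ℕ (λ b →
      1 ≤ b × b < prodS (Qvec B e P) S
      × a * prodS (Qvec B e P) S ≡ b * q
      × (∀ j → j ∈ S → ¬ (lookup (Qvec B e P) j ∣ b))))
lemma12p5 B e P H _ H≤P q d a 2≤q q≤H lq≡d _ 1≤a a<q a⊥q =
  minimal-cover⇒representation (Qvec B e P) (Qvec≢0 B e P 1≤P) lq≡d 1≤a a<q a⊥q
  where
  1≤P : 1 ≤ P
  1≤P = ≤-trans (<⇒≤ 2≤q) (≤-trans q≤H H≤P)
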